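{- Let $\Gamma$ be an Abelian group with $|\Gamma|=2^{2\alpha}$, where $\alpha\geq 2$ is an integer. Then there exists a $\Gamma$-magic square $\mathrm{MS}_{\Gamma}(2^{\alpha})$ of side $2^\alpha$.
   Context: For an Abelian group $(\Gamma,+)$ of order $n^2$, a $\Gamma$-magic square $\mathrm{MS}_{\Gamma}(n)$ (of side $n$) is an $n\times n$ array whose entries are all the elements of $\Gamma$ (each element appearing exactly once) such that all row sums, all column sums, the sum along the main diagonal and the sum along the backward main diagonal are equal to the same element $\mu\in\Gamma$. -}

module Defs where

open import Level using (Level)
open import Data.Nat using (ℕ; zero; suc; _^_; _*_)
open import Data.Fin using (Fin; zero; suc; opposite)
open import Data.Product using (Σ; _×_; _,_; ∃)
open import Algebra.Bundles using (AbelianGroup)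
open import Relation.Binary.PropositionalEquality using (_≡_)

module _ {c ℓ : Level} (G : AbelianGroup c ℓ) where
  open AbelianGroup G

  gsum : (k : ℕ) → (Fin k → Carrier) → Carrier
  gsum zero    f = ε
  gsum (suc k) f = f zero ∙ gsum k (λ i → f (suc i))

  HasOrder : ℕ → Set (c Level.⊔ ℓ)
  HasOrder k = Σ (Fin k → Carrier) λ e →
    (∀ i j → e i ≈ e j → i ≡ j)
    × (∀ x → ∃ λ i → e i ≈ x)

  IsArrayOfAll : (n : ℕ) → (Fin n → Fin n → Carrier) → Set (c Level.⊔ ℓ)
  IsArrayOfAll n M =
    (∀ i j i′ j′ → M i j ≈ M i′ j′ → (i ≡ i′) × (j ≡ j′))
    × (∀ x → ∃ λ i → ∃ λ j → M i j ≈ x)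

  IsMagicSquare : (n : ℕ) → (Fin n → Fin n → Carrier) → Set (c Level.⊔ ℓ)
  IsMagicSquare n M = IsArrayOfAll n M × ∃ λ μ →
      (∀ i → gsum n (λ j → M i j) ≈ μ)
    × (∀ j → gsum n (λ i → M i j) ≈ μ)
    × (gsum n (λ i → M i i) ≈ μ)
    × (gsum n (λ i → M i (opposite i)) ≈ μ)

  MagicSquare : ℕ → Set (c Level.⊔ ℓ)
  MagicSquare n = Σ (Fin n → Fin n → Carrier) (IsMagicSquare n)

-- Γ is the internal direct sum of a subgroup H of order 2^α and a set B of 2^α coset representatives:
-- a subgroup H of order 2^j < |Γ| is extended to one of order 2^(j+1) by some u ∉ H with 2u ∈ H, since
-- otherwise the complement of H splits into blocks (x + H) ∪ (−x + H) of 2^(j+1) elements and |Γ| would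
-- be an odd multiple of 2^j.  Given orthogonal Latin squares σ, τ of order 2^α whose two diagonals are
-- also transversals, M i j = b (σ i j) + h (τ i j) lists every element of Γ once, and every row, column
-- and diagonal meets each b and each h exactly once, so all of them sum to Σ b + Σ h.  Such pairs of
-- squares exist for orders 4 and 8, and the product σ ⊗ σ′ yields all orders 2^α with α ≥ 2.
module Submission where

open import Defs
open import Level using (Level; _⊔_)
open import Data.Nat as ℕ using (ℕ; zero; suc; _+_; _*_; _^_; _≤_; _<_; s≤s; z≤n)
import Data.Nat.Properties as ℕ
open import Data.Nat.Solver using (module +-*-Solver)
open import Data.Fin as Fin
  using (Fin; zero; suc; opposite; toℕ; combine; remQuot; quotient; remainder; splitAt; join; _↑ˡ_; _↑ʳ_; #_)
import Data.Fin.Properties as Fin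
open import Data.Vec using (Vec; []; _∷_; lookup)
open import Data.Vec.Functional as Vector using (Vector; _++_; concat)
import Data.Vec.Functional.Properties as Vector
open import Data.Product as Product using (Σ; ∃; ∃₂; _×_; _,_; proj₁; proj₂; uncurry; <_,_>)
import Data.Product.Properties as Product
open import Data.Sum using (_⊎_; inj₁; inj₂; [_,_])
open import Data.Unit using (⊤; tt)
open import Data.Empty using (⊥-elim)
open import Function using (_∘_)
open import Function.Bundles using (mk↔ₛ′)
open import Function.Definitions using (Injective; StrictlySurjective)
open import Relation.Nullary using (Dec; yes; no; ¬_)
open import Relation.Nullary.Decidable using (True; toWitness; map′; _×-dec_; _→-dec_; ¬?; decidable-stable; toSum)
open import Relation.Binary.Definitions using (Decidable)
open import Relation.Binary.PropositionalEquality as ≡ using (_≡_; _≢_)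
open import Algebra.Bundles using (AbelianGroup)

private variable
  A B C D : Set
  k k′ m m′ n : ℕ

Bijective : (A → B) → Set
Bijective f = Injective _≡_ _≡_ f × StrictlySurjective _≡_ f

invertible⇒bijective : {f : A → B} (g : B → A) →
  (∀ x → g (f x) ≡ x) → (∀ y → f (g y) ≡ y) → Bijective f
invertible⇒bijective g g∘f f∘g =
  (λ {x} {y} fx≡fy → ≡.trans (≡.sym (g∘f x)) (≡.trans (≡.cong g fx≡fy) (g∘f y))) ,
  (λ y → g y , f∘g y)

bijective-∘ : {f : A → B} {g : B → C} → Bijective f → Bijective g → Bijective (g ∘ f)
bijective-∘ {g = g} (f-inj , f-surj) (g-inj , g-surj) =
  (λ eq → f-inj (g-inj eq)) ,
  (λ z → let y , gy≡z = g-surj z ; x , fx≡y = f-surj y in x , ≡.trans (≡.cong g fx≡y) gy≡z)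

bijective-map : {f : A → B} {g : C → D} → Bijective f → Bijective g → Bijective (Product.map f g)
bijective-map (f-inj , f-surj) (g-inj , g-surj) =
  (λ eq → let e₁ , e₂ = Product.×-≡,≡←≡ eq in Product.×-≡,≡→≡ (f-inj e₁ , g-inj e₂)) ,
  (λ (y , z) → let x , fx≡y = f-surj y ; w , gw≡z = g-surj z in (x , w) , ≡.cong₂ _,_ fx≡y gw≡z)

bijective-≗ : {f g : A → B} → (∀ x → f x ≡ g x) → Bijective f → Bijective g
bijective-≗ f≗g (f-inj , f-surj) =
  (λ {x} {y} gx≡gy → f-inj (≡.trans (f≗g x) (≡.trans gx≡gy (≡.sym (f≗g y))))) ,
  (λ y → let x , fx≡y = f-surj y in x , ≡.trans (≡.sym (f≗g x)) fx≡y)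

bijective? : (f : Fin k → Fin m) → Dec (Bijective f)
bijective? f =
  map′ (λ inj {x} {y} → inj x y) (λ inj x y → inj)
       (Fin.all? λ x → Fin.all? λ y → (f x Fin.≟ f y) →-dec (x Fin.≟ y))
  ×-dec Fin.all? (λ y → Fin.any? λ x → f x Fin.≟ y)

combine-bijective : Bijective (uncurry (combine {k} {m}))
combine-bijective {k} {m} = invertible⇒bijective (remQuot m) (λ (i , j) → Fin.remQuot-combine i j) (Fin.combine-remQuot {k} m)

remQuot-bijective : Bijective (remQuot {k} m)
remQuot-bijective {k} {m} = invertible⇒bijective (uncurry combine) (Fin.combine-remQuot {k} m) (λ (i , j) → Fin.remQuot-combine i j)

transpose : (A × B) × (C × D) → (A × C) × (B × D)
transpose ((a , b) , (c , d)) = (a , c) , (b , d)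

transpose-bijective : Bijective (transpose {A} {B} {C} {D})
transpose-bijective = invertible⇒bijective transpose (λ _ → ≡.refl) (λ _ → ≡.refl)

_⊠_ : (Fin k → Fin k′) → (Fin m → Fin m′) → Fin (k * m) → Fin (k′ * m′)
_⊠_ {m = m} f g = uncurry combine ∘ Product.map f g ∘ remQuot m

⊠-bijective : {f : Fin k → Fin k′} {g : Fin m → Fin m′} → Bijective f → Bijective g → Bijective (f ⊠ g)
⊠-bijective f-bij g-bij = bijective-∘ remQuot-bijective (bijective-∘ (bijective-map f-bij g-bij) combine-bijective)

suc[toℕ+toℕ-opposite] : (i : Fin n) → suc (toℕ i + toℕ (opposite i)) ≡ n
suc[toℕ+toℕ-opposite] i = ≡.trans (≡.cong (λ o → suc (toℕ i + o)) (Fin.opposite-prop i)) (ℕ.m+[n∸m]≡n (Fin.toℕ<n i))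

opposite-combine : (i : Fin k) (j : Fin m) → opposite (combine i j) ≡ combine (opposite i) (opposite j)
opposite-combine {k} {m} i j = Fin.toℕ-injective (ℕ.+-cancelˡ-≡ (suc (toℕ (combine i j))) _ _ (begin
  suc (toℕ (combine i j)) + toℕ (opposite (combine i j)) ≡⟨ suc[toℕ+toℕ-opposite] (combine i j) ⟩
  k * m
    ≡⟨ ≡.cong₂ _*_ (≡.sym (suc[toℕ+toℕ-opposite] i)) (≡.sym (suc[toℕ+toℕ-opposite] j)) ⟩
  suc (x + x′) * suc (y + y′)           ≡⟨ arithmetic x x′ y y′ ⟩
  suc (suc (y + y′) * x + y) + (suc (y + y′) * x′ + y′)
    ≡⟨ ≡.cong (λ m → suc (m * x + y) + (m * x′ + y′)) (suc[toℕ+toℕ-opposite] j) ⟩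
  suc (m * x + y) + (m * x′ + y′)
    ≡⟨ ≡.sym (≡.cong₂ (λ u v → suc u + v) (Fin.toℕ-combine i j) (Fin.toℕ-combine (opposite i) (opposite j))) ⟩
  suc (toℕ (combine i j)) + toℕ (combine (opposite i) (opposite j)) ∎))
  where
  open ≡.≡-Reasoning
  x x′ y y′ : ℕ
  x = toℕ i
  x′ = toℕ (opposite i)
  y = toℕ j
  y′ = toℕ (opposite j)
  arithmetic : ∀ x x′ y y′ → suc (x + x′) * suc (y + y′) ≡ suc (suc (y + y′) * x + y) + (suc (y + y′) * x′ + y′)
  arithmetic = +-*-Solver.solve 4 (λ x x′ y y′ →
    (con 1 :+ (x :+ x′)) :* (con 1 :+ (y :+ y′))
      := con 1 :+ ((con 1 :+ (y :+ y′)) :* x :+ y) :+ ((con 1 :+ (y :+ y′)) :* x′ :+ y′)) ≡.refl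
    where open +-*-Solver

remQuot-opposite : (I : Fin (k * m)) → remQuot m (opposite I) ≡ Product.map opposite opposite (remQuot m I)
remQuot-opposite {k} {m} I = begin
  split (opposite I)                     ≡⟨ ≡.cong (split ∘ opposite) (≡.sym (Fin.combine-remQuot {k} m I)) ⟩
  split (opposite (combine i j))         ≡⟨ ≡.cong split (opposite-combine i j) ⟩
  split (combine (opposite i) (opposite j)) ≡⟨ Fin.remQuot-combine (opposite i) (opposite j) ⟩
  (opposite i , opposite j)              ∎
  where
  open ≡.≡-Reasoning
  split : Fin (k * m) → Fin k × Fin m
  split = remQuot m
  i : Fin k
  i = quotient m I
  j : Fin m
  j = remainder {k} m I

Square : ℕ → Set
Square n = Fin n → Fin n → Fin n

record DiagonalLatin (σ : Square n) : Set where
  constructor mkDiagonalLatin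
  field
    rows         : ∀ i → Bijective (σ i)
    columns      : ∀ j → Bijective (λ i → σ i j)
    diagonal     : Bijective (λ i → σ i i)
    antidiagonal : Bijective (λ i → σ i (opposite i))

Orthogonal : Square n → Square n → Set
Orthogonal σ τ = Bijective < uncurry σ , uncurry τ >

diagonalLatin? : (σ : Square n) → Dec (DiagonalLatin σ)
diagonalLatin? σ = map′ (λ (r , c , d , a) → mkDiagonalLatin r c d a)
                        (λ L → let open DiagonalLatin L in rows , columns , diagonal , antidiagonal)
  (Fin.all? (bijective? ∘ σ) ×-dec Fin.all? (λ j → bijective? (λ i → σ i j))
   ×-dec bijective? (λ i → σ i i) ×-dec bijective? (λ i → σ i (opposite i)))

orthogonal? : (σ τ : Square n) → Dec (Orthogonal σ τ)
orthogonal? {n} σ τ = map′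
  (λ flat-bij → bijective-≗ unflatten (bijective-∘ combine-bijective (bijective-∘ flat-bij remQuot-bijective)))
  (λ bij → bijective-∘ remQuot-bijective (bijective-∘ bij combine-bijective))
  (bijective? flat)
  where
  Φ : Fin n × Fin n → Fin n × Fin n
  Φ = < uncurry σ , uncurry τ >
  flat : Fin (n * n) → Fin (n * n)
  flat = uncurry combine ∘ Φ ∘ remQuot n
  unflatten : ∀ p → remQuot n (flat (uncurry combine p)) ≡ Φ p
  unflatten (i , j) = ≡.trans (Fin.remQuot-combine _ _) (≡.cong Φ (Fin.remQuot-combine i j))

_⊗_ : Square k → Square m → Square (k * m)
_⊗_ {k} {m} σ σ′ I J = combine (σ (quotient m I) (quotient m J)) (σ′ (remainder {k} m I) (remainder {k} m J))

⊗-diagonalLatin : {σ : Square k} {σ′ : Square m} → DiagonalLatin σ → DiagonalLatin σ′ → DiagonalLatin (σ ⊗ σ′)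
⊗-diagonalLatin {k} {m} {σ} {σ′} L L′ = record
  { rows         = λ I → ⊠-bijective (L.rows (quotient m I)) (L′.rows (remainder {k} m I))
  ; columns      = λ J → ⊠-bijective (L.columns (quotient m J)) (L′.columns (remainder {k} m J))
  ; diagonal     = ⊠-bijective L.diagonal L′.diagonal
  ; antidiagonal = bijective-≗ antidiagonal-⊠ (⊠-bijective L.antidiagonal L′.antidiagonal)
  }
  where
  module L = DiagonalLatin L
  module L′ = DiagonalLatin L′
  antidiagonal-⊠ : ∀ I → ((λ i → σ i (opposite i)) ⊠ (λ i → σ′ i (opposite i))) I ≡ (σ ⊗ σ′) I (opposite I)
  antidiagonal-⊠ I = ≡.cong (λ (i , j) → combine (σ (quotient m I) i) (σ′ (remainder {k} m I) j)) (≡.sym (remQuot-opposite I))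

-- The superposition of σ ⊗ σ′ and τ ⊗ τ′ unfolds to: split both indices, transpose,
-- superpose σ, τ and σ′, τ′ componentwise, transpose, combine.
⊗-orthogonal : {σ τ : Square k} {σ′ τ′ : Square m} →
  Orthogonal σ τ → Orthogonal σ′ τ′ → Orthogonal (σ ⊗ σ′) (τ ⊗ τ′)
⊗-orthogonal {k} {m} orth orth′ =
  bijective-∘ (bijective-map (remQuot-bijective {k} {m}) remQuot-bijective)
  (bijective-∘ transpose-bijective
  (bijective-∘ (bijective-map orth orth′)
  (bijective-∘ transpose-bijective
               (bijective-map combine-bijective combine-bijective))))

record OrthogonalDiagonalLatinSquares (n : ℕ) : Set where
  field
    σ τ             : Square n
    σ-diagonalLatin : DiagonalLatin σ
    τ-diagonalLatin : DiagonalLatin τ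
    orthogonal      : Orthogonal σ τ

_⊗ᴼ_ : OrthogonalDiagonalLatinSquares k → OrthogonalDiagonalLatinSquares m → OrthogonalDiagonalLatinSquares (k * m)
L ⊗ᴼ L′ = record
  { σ               = L.σ ⊗ L′.σ
  ; τ               = L.τ ⊗ L′.τ
  ; σ-diagonalLatin = ⊗-diagonalLatin L.σ-diagonalLatin L′.σ-diagonalLatin
  ; τ-diagonalLatin = ⊗-diagonalLatin L.τ-diagonalLatin L′.τ-diagonalLatin
  ; orthogonal      = ⊗-orthogonal L.orthogonal L′.orthogonal
  }
  where
  module L = OrthogonalDiagonalLatinSquares L
  module L′ = OrthogonalDiagonalLatinSquares L′

fromTable : Vec (Vec (Fin n) n) n → Square n
fromTable S i j = lookup (lookup S i) j

fromTables : (S T : Vec (Vec (Fin n) n) n) →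
  True (diagonalLatin? (fromTable S) ×-dec diagonalLatin? (fromTable T) ×-dec orthogonal? (fromTable S) (fromTable T)) →
  OrthogonalDiagonalLatinSquares n
fromTables S T checked = let σ-diagonalLatin , τ-diagonalLatin , orthogonal = toWitness checked in record
  { σ = fromTable S ; τ = fromTable T
  ; σ-diagonalLatin = σ-diagonalLatin ; τ-diagonalLatin = τ-diagonalLatin ; orthogonal = orthogonal }

odls₄ : OrthogonalDiagonalLatinSquares 4
odls₄ = fromTables
  ((# 0 ∷ # 2 ∷ # 3 ∷ # 1 ∷ []) ∷
   (# 1 ∷ # 3 ∷ # 2 ∷ # 0 ∷ []) ∷
   (# 2 ∷ # 0 ∷ # 1 ∷ # 3 ∷ []) ∷
   (# 3 ∷ # 1 ∷ # 0 ∷ # 2 ∷ []) ∷ [])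
  ((# 0 ∷ # 3 ∷ # 1 ∷ # 2 ∷ []) ∷
   (# 1 ∷ # 2 ∷ # 0 ∷ # 3 ∷ []) ∷
   (# 2 ∷ # 1 ∷ # 3 ∷ # 0 ∷ []) ∷
   (# 3 ∷ # 0 ∷ # 2 ∷ # 1 ∷ []) ∷ [])
  _

odls₈ : OrthogonalDiagonalLatinSquares 8
odls₈ = fromTables
  ((# 0 ∷ # 2 ∷ # 4 ∷ # 6 ∷ # 3 ∷ # 1 ∷ # 7 ∷ # 5 ∷ []) ∷
   (# 1 ∷ # 3 ∷ # 5 ∷ # 7 ∷ # 2 ∷ # 0 ∷ # 6 ∷ # 4 ∷ []) ∷
   (# 2 ∷ # 0 ∷ # 6 ∷ # 4 ∷ # 1 ∷ # 3 ∷ # 5 ∷ # 7 ∷ []) ∷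
   (# 3 ∷ # 1 ∷ # 7 ∷ # 5 ∷ # 0 ∷ # 2 ∷ # 4 ∷ # 6 ∷ []) ∷
   (# 4 ∷ # 6 ∷ # 0 ∷ # 2 ∷ # 7 ∷ # 5 ∷ # 3 ∷ # 1 ∷ []) ∷
   (# 5 ∷ # 7 ∷ # 1 ∷ # 3 ∷ # 6 ∷ # 4 ∷ # 2 ∷ # 0 ∷ []) ∷
   (# 6 ∷ # 4 ∷ # 2 ∷ # 0 ∷ # 5 ∷ # 7 ∷ # 1 ∷ # 3 ∷ []) ∷
   (# 7 ∷ # 5 ∷ # 3 ∷ # 1 ∷ # 4 ∷ # 6 ∷ # 0 ∷ # 2 ∷ []) ∷ [])
  ((# 0 ∷ # 3 ∷ # 6 ∷ # 5 ∷ # 7 ∷ # 4 ∷ # 1 ∷ # 2 ∷ []) ∷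
   (# 1 ∷ # 2 ∷ # 7 ∷ # 4 ∷ # 6 ∷ # 5 ∷ # 0 ∷ # 3 ∷ []) ∷
   (# 2 ∷ # 1 ∷ # 4 ∷ # 7 ∷ # 5 ∷ # 6 ∷ # 3 ∷ # 0 ∷ []) ∷
   (# 3 ∷ # 0 ∷ # 5 ∷ # 6 ∷ # 4 ∷ # 7 ∷ # 2 ∷ # 1 ∷ []) ∷
   (# 4 ∷ # 7 ∷ # 2 ∷ # 1 ∷ # 3 ∷ # 0 ∷ # 5 ∷ # 6 ∷ []) ∷
   (# 5 ∷ # 6 ∷ # 3 ∷ # 0 ∷ # 2 ∷ # 1 ∷ # 4 ∷ # 7 ∷ []) ∷
   (# 6 ∷ # 5 ∷ # 0 ∷ # 3 ∷ # 1 ∷ # 2 ∷ # 7 ∷ # 4 ∷ []) ∷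
   (# 7 ∷ # 4 ∷ # 1 ∷ # 2 ∷ # 0 ∷ # 3 ∷ # 6 ∷ # 5 ∷ []) ∷ [])
  _

odls-2^ : ∀ α → 2 ≤ α → OrthogonalDiagonalLatinSquares (2 ^ α)
odls-2^ 1 (s≤s ())
odls-2^ 2 _ = odls₄
odls-2^ 3 _ = odls₈
odls-2^ (suc (suc (suc (suc α)))) _ =
  ≡.subst OrthogonalDiagonalLatinSquares (ℕ.*-assoc 2 2 (2 ^ suc (suc α))) (odls₄ ⊗ᴼ odls-2^ (suc (suc α)) (s≤s (s≤s z≤n)))

module _ {c ℓ : Level} (G : AbelianGroup c ℓ) where
  open AbelianGroup G
  open import Algebra.Properties.CommutativeMonoid.Sum commutativeMonoid using (sum; sum-permute; ∑-distrib-+)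
  open import Relation.Binary.Reasoning.Setoid setoid

  gsum≈sum : ∀ n f → gsum G n f ≈ sum f
  gsum≈sum zero    f = refl
  gsum≈sum (suc n) f = ∙-congˡ (gsum≈sum n (f ∘ suc))

  sum-∘-bijective : ∀ {n} (f : Fin n → Carrier) {π : Fin n → Fin n} → Bijective π → sum (f ∘ π) ≈ sum f
  sum-∘-bijective f {π} (π-inj , π-surj) =
    sym (sum-permute f (mk↔ₛ′ π (proj₁ ∘ π-surj) (proj₂ ∘ π-surj) (λ i → π-inj (proj₂ (π-surj (π i))))))

  line-sum : ∀ {n} (b a : Fin n → Carrier) {π ρ : Fin n → Fin n} → Bijective π → Bijective ρ →
    gsum G n (λ j → b (π j) ∙ a (ρ j)) ≈ sum b ∙ sum a
  line-sum {n} b a {π} {ρ} π-bij ρ-bij = begin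
    gsum G n (λ j → b (π j) ∙ a (ρ j))   ≈⟨ gsum≈sum n _ ⟩
    sum (λ j → b (π j) ∙ a (ρ j))        ≈⟨ ∑-distrib-+ (b ∘ π) (a ∘ ρ) ⟩
    sum (b ∘ π) ∙ sum (a ∘ ρ)            ≈⟨ ∙-cong (sum-∘-bijective b π-bij) (sum-∘-bijective a ρ-bij) ⟩
    sum b ∙ sum a                        ∎

  isArrayOfAll-∘-orthogonal : ∀ {n} {F : Fin n → Fin n → Carrier} {σ τ : Square n} →
    IsArrayOfAll G n F → Orthogonal σ τ → IsArrayOfAll G n (λ i j → F (σ i j) (τ i j))
  isArrayOfAll-∘-orthogonal {F = F} {σ} {τ} (F-inj , F-surj) (orth-inj , orth-surj) =
    (λ i j i′ j′ eq → let σ≡ , τ≡ = F-inj _ _ _ _ eq in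
       Product.×-≡,≡←≡ (orth-inj (Product.×-≡,≡→≡ (σ≡ , τ≡)))) ,
    (λ x → let p , q , Fpq≈x = F-surj x ; (i , j) , στ≡pq = orth-surj (p , q) in
       i , j , trans (reflexive (≡.cong (λ (p , q) → F p q) στ≡pq)) Fpq≈x)

  magicSquare : ∀ {n} (b a : Fin n → Carrier) → IsArrayOfAll G n (λ p q → b p ∙ a q) →
    OrthogonalDiagonalLatinSquares n → MagicSquare G n
  magicSquare b a ba-lists-G L =
    (λ i j → b (σ i j) ∙ a (τ i j)) ,
    isArrayOfAll-∘-orthogonal ba-lists-G orthogonal ,
    sum b ∙ sum a ,
    (λ i → line-sum b a (rows σ-diagonalLatin i) (rows τ-diagonalLatin i)) ,
    (λ j → line-sum b a (columns σ-diagonalLatin j) (columns τ-diagonalLatin j)) ,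
    line-sum b a (diagonal σ-diagonalLatin) (diagonal τ-diagonalLatin) ,
    line-sum b a (antidiagonal σ-diagonalLatin) (antidiagonal τ-diagonalLatin)
    where
    open OrthogonalDiagonalLatinSquares L
    open DiagonalLatin

2^j*odd≢2^t : ∀ {j t} k → j < t → 2 ^ j * suc (2 * k) ≢ 2 ^ t
2^j*odd≢2^t {j} k j<t eq with ℕ.m≤n⇒∃[o]m+o≡n j<t
... | d , ≡.refl = ℕ.even≢odd (2 ^ d) k (≡.sym (ℕ.*-cancelˡ-≡ _ _ (2 ^ j) {{ℕ.m^n≢0 2 j}} (begin
  2 ^ j * suc (2 * k)   ≡⟨ eq ⟩
  2 ^ (suc j + d)       ≡⟨ ≡.cong (2 ^_) (≡.sym (ℕ.+-suc j d)) ⟩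
  2 ^ (j + suc d)       ≡⟨ ℕ.^-distribˡ-+-* 2 j (suc d) ⟩
  2 ^ j * 2 ^ suc d     ∎)))
  where open ≡.≡-Reasoning

module FiniteAbelianGroup {c ℓ : Level} (G : AbelianGroup c ℓ) {N : ℕ} (order : HasOrder G N) where
  open AbelianGroup G
  open import Algebra.Properties.AbelianGroup G
  open import Algebra.Solver.CommutativeMonoid commutativeMonoid using (solve; _⊕_; _⊜_)
  open import Relation.Binary.Reasoning.Setoid setoid

  private variable
    p : Level
    a b d u x y z : Carrier

  x∙a≈y∙b⇒x≈y∙[b∙a⁻¹] : x ∙ a ≈ y ∙ b → x ≈ y ∙ (b ∙ a ⁻¹)
  x∙a≈y∙b⇒x≈y∙[b∙a⁻¹] {x} {a} {y} {b} eq = begin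
    x                ≈⟨ //-rightDividesʳ a x ⟨
    (x ∙ a) ∙ a ⁻¹   ≈⟨ ∙-congʳ eq ⟩
    (y ∙ b) ∙ a ⁻¹   ≈⟨ assoc y b (a ⁻¹) ⟩
    y ∙ (b ∙ a ⁻¹)   ∎

  x≈y∙d⇒x⁻¹≈y⁻¹∙d⁻¹ : x ≈ y ∙ d → x ⁻¹ ≈ y ⁻¹ ∙ d ⁻¹
  x≈y∙d⇒x⁻¹≈y⁻¹∙d⁻¹ {y = y} {d} eq = trans (⁻¹-cong eq) (sym (⁻¹-∙-comm y d))

  x≈x⁻¹∙d⇒x∙x≈d : x ≈ x ⁻¹ ∙ d → x ∙ x ≈ d
  x≈x⁻¹∙d⇒x∙x≈d {x} {d} eq = trans (∙-congˡ eq) (\\-leftDividesˡ x d)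

  [u∙a]∙[u∙b]⁻¹≈a∙b⁻¹ : ∀ u a b → (u ∙ a) ∙ (u ∙ b) ⁻¹ ≈ a ∙ b ⁻¹
  [u∙a]∙[u∙b]⁻¹≈a∙b⁻¹ u a b = begin
    (u ∙ a) ∙ (u ∙ b) ⁻¹        ≈⟨ ∙-congˡ (⁻¹-∙-comm u b) ⟨
    (u ∙ a) ∙ (u ⁻¹ ∙ b ⁻¹)
      ≈⟨ solve 4 (λ u a u′ b′ → (u ⊕ a) ⊕ (u′ ⊕ b′) ⊜ (u ⊕ u′) ⊕ (a ⊕ b′)) refl u a (u ⁻¹) (b ⁻¹) ⟩
    (u ∙ u ⁻¹) ∙ (a ∙ b ⁻¹)     ≈⟨ ∙-congʳ (inverseʳ u) ⟩
    ε ∙ (a ∙ b ⁻¹)              ≈⟨ identityˡ _ ⟩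
    a ∙ b ⁻¹                    ∎

  a∙[u∙b]⁻¹≈u∙[a∙b⁻¹∙[u∙u]⁻¹] : ∀ u a b → a ∙ (u ∙ b) ⁻¹ ≈ u ∙ ((a ∙ b ⁻¹) ∙ (u ∙ u) ⁻¹)
  a∙[u∙b]⁻¹≈u∙[a∙b⁻¹∙[u∙u]⁻¹] u a b = sym (begin
    u ∙ ((a ∙ b ⁻¹) ∙ (u ∙ u) ⁻¹)      ≈⟨ ∙-congˡ (∙-congˡ (⁻¹-∙-comm u u)) ⟨
    u ∙ ((a ∙ b ⁻¹) ∙ (u ⁻¹ ∙ u ⁻¹))
      ≈⟨ solve 4 (λ u a b′ u′ → u ⊕ ((a ⊕ b′) ⊕ (u′ ⊕ u′)) ⊜ (u ⊕ u′) ⊕ (a ⊕ (u′ ⊕ b′))) refl u a (b ⁻¹) (u ⁻¹) ⟩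
    (u ∙ u ⁻¹) ∙ (a ∙ (u ⁻¹ ∙ b ⁻¹))   ≈⟨ ∙-congʳ (inverseʳ u) ⟩
    ε ∙ (a ∙ (u ⁻¹ ∙ b ⁻¹))            ≈⟨ identityˡ _ ⟩
    a ∙ (u ⁻¹ ∙ b ⁻¹)                  ≈⟨ ∙-congˡ (⁻¹-∙-comm u b) ⟩
    a ∙ (u ∙ b) ⁻¹                     ∎)

  infix 4 _∈_ _∈?_

  _∈_ : Carrier → Vector Carrier k → Set ℓ
  x ∈ v = ∃ λ i → v i ≈ x

  ∈-resp-≈ : {v : Vector Carrier k} → x ≈ y → x ∈ v → y ∈ v
  ∈-resp-≈ x≈y (i , vi≈x) = i , trans vi≈x x≈y

  ∈-++⁺ˡ : {v : Vector Carrier k} {w : Vector Carrier m} → x ∈ v → x ∈ (v ++ w)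
  ∈-++⁺ˡ {v = v} {w = w} (i , vi≈x) = i ↑ˡ _ , trans (reflexive (Vector.lookup-++ˡ v w i)) vi≈x

  ∈-++⁺ʳ : {v : Vector Carrier k} {w : Vector Carrier m} → x ∈ w → x ∈ (v ++ w)
  ∈-++⁺ʳ {v = v} {w} (i , wi≈x) = _ ↑ʳ i , trans (reflexive (Vector.lookup-++ʳ v w i)) wi≈x

  ∈-++⁻ : (v : Vector Carrier k) {w : Vector Carrier m} → x ∈ (v ++ w) → x ∈ v ⊎ x ∈ w
  ∈-++⁻ {k = k} v (I , eq) with splitAt k I
  ... | inj₁ i = inj₁ (i , eq)
  ... | inj₂ j = inj₂ (j , eq)

  ++-∀ : {P : Carrier → Set p} {v : Vector Carrier k} {w : Vector Carrier m} →
    (∀ i → P (v i)) → (∀ j → P (w j)) → ∀ I → P ((v ++ w) I)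
  ++-∀ {k = k} P-v P-w I with splitAt k I
  ... | inj₁ i = P-v i
  ... | inj₂ j = P-w j

  ++-injective : {v : Vector Carrier k} {w : Vector Carrier m} →
    Injective _≡_ _≈_ v → Injective _≡_ _≈_ w → (∀ i j → ¬ v i ≈ w j) → Injective _≡_ _≈_ (v ++ w)
  ++-injective {k} {m} {v} {w} v-inj w-inj disjoint {I} {J} eq =
    splitAt-injective (on-sum (splitAt k I) (splitAt k J) eq)
    where
    splitAt-injective : Injective _≡_ _≡_ (splitAt k {m})
    splitAt-injective = proj₁ (invertible⇒bijective (join k m) (Fin.join-splitAt k m) (Fin.splitAt-join k m))
    on-sum : ∀ s t → [ v , w ] s ≈ [ v , w ] t → s ≡ t
    on-sum (inj₁ i) (inj₁ j) eq = ≡.cong inj₁ (v-inj eq)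
    on-sum (inj₁ i) (inj₂ j) eq = ⊥-elim (disjoint i j eq)
    on-sum (inj₂ i) (inj₁ j) eq = ⊥-elim (disjoint j i (sym eq))
    on-sum (inj₂ i) (inj₂ j) eq = ≡.cong inj₂ (w-inj eq)

  private
    enum : Fin N → Carrier
    enum = proj₁ order

    enum-injective : ∀ i j → enum i ≈ enum j → i ≡ j
    enum-injective = proj₁ (proj₂ order)

  index : Carrier → Fin N
  index x = proj₁ (proj₂ (proj₂ order) x)

  enum-index : ∀ x → enum (index x) ≈ x
  enum-index x = proj₂ (proj₂ (proj₂ order) x)

  index-cong : x ≈ y → index x ≡ index y
  index-cong {x} {y} x≈y = enum-injective _ _ (trans (enum-index x) (trans x≈y (sym (enum-index y))))

  index-injective : Injective _≈_ _≡_ index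
  index-injective {x} {y} eq = trans (sym (enum-index x)) (trans (reflexive (≡.cong enum eq)) (enum-index y))

  _≟_ : Decidable _≈_
  x ≟ y = map′ index-injective index-cong (index x Fin.≟ index y)

  _∈?_ : ∀ x (v : Vector Carrier k) → Dec (x ∈ v)
  x ∈? v = Fin.any? λ i → v i ≟ x

  Enumerates : Vector Carrier k → (Carrier → Set p) → Set (c ⊔ ℓ ⊔ p)
  Enumerates v P = Injective _≡_ _≈_ v × (∀ i → P (v i)) × (∀ x → P x → x ∈ v)

  enumerates-size : {v : Vector Carrier k} {P : Carrier → Set p} → Enumerates v P → (∀ x → P x) → k ≡ N
  enumerates-size {k} {v = v} (v-inj , _ , v-surj) all-P =
    ℕ.≤-antisym (Fin.injective⇒≤ (v-inj ∘ index-injective)) (Fin.injective⇒≤ (enum-injective _ _ ∘ position-≈))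
    where
    position : Fin N → Fin k
    position i = proj₁ (v-surj (enum i) (all-P _))
    position-≈ : ∀ {i j} → position i ≡ position j → enum i ≈ enum j
    position-≈ {i} {j} eq = trans (sym (proj₂ (v-surj (enum i) _))) (trans (reflexive (≡.cong v eq)) (proj₂ (v-surj (enum j) _)))

  enumerates-++ : {v : Vector Carrier k} {w : Vector Carrier m} {P Q : Carrier → Set p} →
    Enumerates v P → Enumerates w Q → (∀ i j → ¬ v i ≈ w j) → Enumerates (v ++ w) (λ x → P x ⊎ Q x)
  enumerates-++ {v = v} {w} {P} {Q} (v-inj , v-P , v-surj) (w-inj , w-Q , w-surj) disjoint =
    ++-injective v-inj w-inj disjoint ,
    ++-∀ {P = λ x → P x ⊎ Q x} {v = v} {w} (inj₁ ∘ v-P) (inj₂ ∘ w-Q) ,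
    λ { x (inj₁ Px) → ∈-++⁺ˡ (v-surj x Px) ; x (inj₂ Qx) → ∈-++⁺ʳ (w-surj x Qx) }

  Tiles : (Fin k → Fin m → Carrier) → (Carrier → Set p) → Set (c ⊔ ℓ ⊔ p)
  Tiles M S = (∀ i j i′ j′ → M i j ≈ M i′ j′ → i ≡ i′ × j ≡ j′)
            × (∀ i j → S (M i j))
            × (∀ x → S x → ∃₂ λ i j → M i j ≈ x)

  tiles⇒enumerates : {M : Fin k → Fin m → Carrier} {S : Carrier → Set p} → Tiles M S → Enumerates (concat M) S
  tiles⇒enumerates {k} {m} {M = M} (M-inj , M-S , M-surj) =
    (λ eq → proj₁ (remQuot-bijective {k} {m}) (let i≡ , j≡ = M-inj _ _ _ _ eq in ≡.cong₂ _,_ i≡ j≡)) ,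
    (λ t → M-S _ _) ,
    (λ x Sx → let i , j , Mij≈x = M-surj x Sx in
      combine i j , trans (reflexive (≡.cong (λ (i , j) → M i j) (Fin.remQuot-combine i j))) Mij≈x)

  tiles-size : {M : Fin k → Fin m → Carrier} {S : Carrier → Set p} → Tiles M S → (∀ x → S x) → k * m ≡ N
  tiles-size tiles = enumerates-size (tiles⇒enumerates tiles)

  -- Greedily choose representatives whose blocks are pairwise disjoint until the blocks cover S;
  -- distinct representatives have distinct indices, so fewer than N + 1 are ever chosen.
  module BlockPartition
    {S : Carrier → Set p} (S? : ∀ x → Dec (S x)) (S-resp : ∀ {x y} → x ≈ y → S x → S y)
    (block : Carrier → Vector Carrier m)
    (block-injective : ∀ {x} → S x → Injective _≡_ _≈_ (block x))
    (block-⊆ : ∀ {x} → S x → ∀ j → S (block x j))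
    (∈-block : ∀ {x} → S x → x ∈ block x)
    (block-meet : ∀ {x y} → S x → S y → ∀ {i j} → block x i ≈ block y j → x ∈ block y)
    where

    Covered : Vector Carrier k → Carrier → Set ℓ
    Covered rep x = ∃ λ i → x ∈ block (rep i)

    Disjoint : Vector Carrier k → Set (ℓ ⊔ p)
    Disjoint rep = (∀ i → S (rep i)) × (∀ i j i′ j′ → block (rep i) j ≈ block (rep i′) j′ → i ≡ i′ × j ≡ j′)

    disjoint-size : {rep : Vector Carrier k} → Disjoint rep → k ≤ N
    disjoint-size {rep = rep} (rep-S , rep-disj) = Fin.injective⇒≤ λ {i} {i′} eq →
      let j , bj≈ri = ∈-block (rep-S i) ; j′ , bj′≈ri′ = ∈-block (rep-S i′) in
      proj₁ (rep-disj i j i′ j′ (trans bj≈ri (trans (index-injective eq) (sym bj′≈ri′))))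

    disjoint-∷ : {rep : Vector Carrier k} {z : Carrier} → Disjoint rep → S z → ¬ Covered rep z → Disjoint (z Vector.∷ rep)
    disjoint-∷ {rep = rep} {z = z} (rep-S , rep-disj) Sz uncovered = z∷rep-S , z∷rep-disj
      where
      z∷rep-S : ∀ i → S ((z Vector.∷ rep) i)
      z∷rep-S zero    = Sz
      z∷rep-S (suc i) = rep-S i
      z∷rep-disj : ∀ i j i′ j′ → block ((z Vector.∷ rep) i) j ≈ block ((z Vector.∷ rep) i′) j′ → i ≡ i′ × j ≡ j′
      z∷rep-disj zero    j zero     j′ eq = ≡.refl , block-injective Sz eq
      z∷rep-disj zero    j (suc i′) j′ eq = ⊥-elim (uncovered (i′ , block-meet Sz (rep-S i′) eq))
      z∷rep-disj (suc i) j zero     j′ eq = ⊥-elim (uncovered (i , block-meet Sz (rep-S i) (sym eq)))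
      z∷rep-disj (suc i) j (suc i′) j′ eq = let i≡ , j≡ = rep-disj i j i′ j′ eq in ≡.cong suc i≡ , j≡

    covered? : (rep : Vector Carrier k) → ∀ x → Dec (Covered rep x)
    covered? rep x = Fin.any? λ i → x ∈? block (rep i)

    uncovered-or-covering : (rep : Vector Carrier k) → (∃ λ z → S z × ¬ Covered rep z) ⊎ (∀ x → S x → Covered rep x)
    uncovered-or-covering rep with Fin.any? (λ i → S? (enum i) ×-dec ¬? (covered? rep (enum i)))
    ... | yes (i , S-i , uncovered) = inj₁ (enum i , S-i , uncovered)
    ... | no none = inj₂ λ x Sx → decidable-stable (covered? rep x) λ uncovered →
      none (index x , S-resp (sym (enum-index x)) Sx , λ (i , e∈) → uncovered (i , ∈-resp-≈ (enum-index x) e∈))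

    grow : ∀ fuel {k} (rep : Vector Carrier k) → Disjoint rep → k + fuel ≡ N →
      ∃ λ k → Σ (Vector Carrier k) λ rep → Tiles (λ i j → block (rep i) j) S
    grow fuel rep disjoint k+fuel≡N with uncovered-or-covering rep
    grow fuel rep (rep-S , rep-disj) _ | inj₂ covering =
      _ , rep , rep-disj , (λ i → block-⊆ (rep-S i)) , covering
    grow zero {k} rep disjoint k+0≡N | inj₁ (z , Sz , uncovered) =
      ⊥-elim (ℕ.<-irrefl (≡.trans (≡.sym (ℕ.+-identityʳ k)) k+0≡N) (disjoint-size (disjoint-∷ disjoint Sz uncovered)))
    grow (suc fuel) {k} rep disjoint k+1+fuel≡N | inj₁ (z , Sz , uncovered) =
      grow fuel (z Vector.∷ rep) (disjoint-∷ disjoint Sz uncovered) (≡.trans (≡.sym (ℕ.+-suc k fuel)) k+1+fuel≡N)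

    partition : ∃ λ k → Σ (Vector Carrier k) λ rep → Tiles (λ i j → block (rep i) j) S
    partition = grow N {0} (λ ()) ((λ ()) , (λ ())) ≡.refl

  record Subgroup (m : ℕ) : Set (c ⊔ ℓ) where
    field
      elem           : Vector Carrier m
      elem-injective : Injective _≡_ _≈_ elem
      ε∈             : ε ∈ elem
      ∙⁻¹-closed     : ∀ {x y} → x ∈ elem → y ∈ elem → x ∙ y ⁻¹ ∈ elem

  trivialSubgroup : Subgroup 1
  trivialSubgroup = record
    { elem           = λ _ → ε
    ; elem-injective = λ { {zero} {zero} _ → ≡.refl }
    ; ε∈             = zero , refl
    ; ∙⁻¹-closed     = λ (_ , ε≈x) (_ , ε≈y) → zero , trans (sym (inverseʳ ε)) (∙-cong ε≈x (⁻¹-cong ε≈y))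
    }

  module _ (H : Subgroup m) where
    open Subgroup H

    ⁻¹-closed : x ∈ elem → x ⁻¹ ∈ elem
    ⁻¹-closed x∈H = ∈-resp-≈ (identityˡ _) (∙⁻¹-closed ε∈ x∈H)

    ∈-cancelʳ : x ∙ a ∈ elem → a ∈ elem → x ∈ elem
    ∈-cancelʳ {x} {a} xa∈H a∈H = ∈-resp-≈ (//-rightDividesʳ a x) (∙⁻¹-closed xa∈H a∈H)

    ⁻¹-∈⇒∈ : x ⁻¹ ∈ elem → x ∈ elem
    ⁻¹-∈⇒∈ x⁻¹∈H = ∈-resp-≈ (⁻¹-involutive _) (⁻¹-closed x⁻¹∈H)

    coset : Carrier → Vector Carrier m
    coset x j = x ∙ elem j

    coset-injective : Injective _≡_ _≈_ (coset x)
    coset-injective {x} eq = elem-injective (∙-cancelˡ x _ _ eq)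

    ∈-coset : d ∈ elem → x ≈ y ∙ d → x ∈ coset y
    ∈-coset {y = y} (j , hj≈d) x≈yd = j , trans (∙-congˡ hj≈d) (sym x≈yd)

    x∈coset[x] : x ∈ coset x
    x∈coset[x] = ∈-coset ε∈ (sym (identityʳ _))

    coset-∉ : ¬ x ∈ elem → ∀ j → ¬ coset x j ∈ elem
    coset-∉ x∉H j xh∈H = x∉H (∈-cancelʳ xh∈H (j , refl))

    coset-meet : ∀ {i j} → coset x i ≈ coset y j → x ∈ coset y
    coset-meet {i = i} {j = j} eq = ∈-coset (∙⁻¹-closed (j , refl) (i , refl)) (x∙a≈y∙b⇒x≈y∙[b∙a⁻¹] eq)

    ∈-coset⁻ : x ∈ coset y → ∃ λ d → d ∈ elem × x ≈ y ∙ d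
    ∈-coset⁻ (j , yh≈x) = _ , (j , refl) , sym yh≈x

    coset-resp : y ≈ z → x ∈ coset y → x ∈ coset z
    coset-resp y≈z (j , yh≈x) = j , trans (∙-congʳ (sym y≈z)) yh≈x

    coset-⁻¹ : x ∈ coset y → x ⁻¹ ∈ coset (y ⁻¹)
    coset-⁻¹ (j , yh≈x) = ∈-coset (⁻¹-closed (j , refl)) (x≈y∙d⇒x⁻¹≈y⁻¹∙d⁻¹ (sym yh≈x))

    cosets-meet : z ∈ coset x → z ∈ coset y → x ∈ coset y
    cosets-meet (_ , xh≈z) (_ , yh≈z) = coset-meet (trans xh≈z (sym yh≈z))

    lagrange : ∃ λ k → Σ (Vector Carrier k) λ rep → Tiles (λ i j → rep i ∙ elem j) (λ _ → ⊤)
    lagrange = partition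
      where open BlockPartition (λ _ → yes tt) (λ _ _ → tt) coset (λ _ → coset-injective)
                                (λ _ _ → tt) (λ _ → x∈coset[x]) (λ _ _ → coset-meet)

    extend : ¬ u ∈ elem → u ∙ u ∈ elem → Subgroup (m + m)
    extend {u} u∉H uu∈H = record
      { elem           = elem ++ coset u
      ; elem-injective = ++-injective elem-injective coset-injective
                           (λ i j hi≈uhj → u∉H (∈-cancelʳ (i , hi≈uhj) (j , refl)))
      ; ε∈             = ∈-++⁺ˡ ε∈
      ; ∙⁻¹-closed     = λ x∈ y∈ → closed (∈-++⁻ elem x∈) (∈-++⁻ elem y∈)
      }
      where
      closed : ∀ {x y} → x ∈ elem ⊎ x ∈ coset u → y ∈ elem ⊎ y ∈ coset u → x ∙ y ⁻¹ ∈ (elem ++ coset u)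
      closed (inj₁ x∈H) (inj₁ y∈H) = ∈-++⁺ˡ (∙⁻¹-closed x∈H y∈H)
      closed {x} {y} (inj₂ (i , uhi≈x)) (inj₁ (j , hj≈y)) = ∈-++⁺ʳ (∈-coset (∙⁻¹-closed (i , refl) (j , refl)) (begin
        x ∙ y ⁻¹                   ≈⟨ ∙-cong (sym uhi≈x) (⁻¹-cong (sym hj≈y)) ⟩
        (u ∙ elem i) ∙ elem j ⁻¹   ≈⟨ assoc u (elem i) (elem j ⁻¹) ⟩
        u ∙ (elem i ∙ elem j ⁻¹)   ∎))
      closed {x} {y} (inj₁ (i , hi≈x)) (inj₂ (j , uhj≈y)) =
        ∈-++⁺ʳ (∈-coset (∙⁻¹-closed (∙⁻¹-closed (i , refl) (j , refl)) uu∈H) (begin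
        x ∙ y ⁻¹                   ≈⟨ ∙-cong (sym hi≈x) (⁻¹-cong (sym uhj≈y)) ⟩
        elem i ∙ (u ∙ elem j) ⁻¹   ≈⟨ a∙[u∙b]⁻¹≈u∙[a∙b⁻¹∙[u∙u]⁻¹] u (elem i) (elem j) ⟩
        u ∙ ((elem i ∙ elem j ⁻¹) ∙ (u ∙ u) ⁻¹) ∎))
      closed {x} {y} (inj₂ (i , uhi≈x)) (inj₂ (j , uhj≈y)) = ∈-++⁺ˡ (∈-resp-≈ (begin
        elem i ∙ elem j ⁻¹               ≈⟨ [u∙a]∙[u∙b]⁻¹≈a∙b⁻¹ u (elem i) (elem j) ⟨
        (u ∙ elem i) ∙ (u ∙ elem j) ⁻¹   ≈⟨ ∙-cong uhi≈x (⁻¹-cong uhj≈y) ⟩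
        x ∙ y ⁻¹                         ∎) (∙⁻¹-closed (i , refl) (j , refl)))

    elem-enumerates : Enumerates elem (_∈ elem)
    elem-enumerates = elem-injective , (λ i → i , refl) , (λ _ x∈H → x∈H)

    pairBlock : Carrier → Vector Carrier (m + m)
    pairBlock x = coset x ++ coset (x ⁻¹)

    pairBlock-∉ : ¬ x ∈ elem → ∀ J → ¬ pairBlock x J ∈ elem
    pairBlock-∉ x∉H = ++-∀ {P = λ z → ¬ z ∈ elem} (coset-∉ x∉H) (coset-∉ (x∉H ∘ ⁻¹-∈⇒∈))

    pairBlock-meet : ∀ {I J} → pairBlock x I ≈ pairBlock y J → x ∈ pairBlock y
    pairBlock-meet {x} {y} {I} {J} eq with ∈-++⁻ (coset x) (I , refl) | ∈-++⁻ (coset y) (J , sym eq)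
    ... | inj₁ z∈xH   | inj₁ z∈yH   = ∈-++⁺ˡ (cosets-meet z∈xH z∈yH)
    ... | inj₁ z∈xH   | inj₂ z∈y⁻¹H = ∈-++⁺ʳ (cosets-meet z∈xH z∈y⁻¹H)
    ... | inj₂ z∈x⁻¹H | inj₁ z∈yH   = ∈-++⁺ʳ (∈-resp-≈ (⁻¹-involutive x) (coset-⁻¹ (cosets-meet z∈x⁻¹H z∈yH)))
    ... | inj₂ z∈x⁻¹H | inj₂ z∈y⁻¹H =
      ∈-++⁺ˡ (coset-resp (⁻¹-involutive y) (∈-resp-≈ (⁻¹-involutive x) (coset-⁻¹ (cosets-meet z∈x⁻¹H z∈y⁻¹H))))

    pairBlock-injective : (∀ {u} → u ∙ u ∈ elem → u ∈ elem) → ¬ x ∈ elem → Injective _≡_ _≈_ (pairBlock x)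
    pairBlock-injective halving-closed x∉H = ++-injective coset-injective coset-injective λ i j eq →
      let _ , d∈H , x≈x⁻¹d = ∈-coset⁻ (coset-meet eq) in
      x∉H (halving-closed (∈-resp-≈ (sym (x≈x⁻¹∙d⇒x∙x≈d x≈x⁻¹d)) d∈H))

    -- Listing H, then the k blocks (x + H) ∪ (−x + H) that partition its complement, enumerates Γ.
    odd-index : (∀ {u} → u ∙ u ∈ elem → u ∈ elem) → ∃ λ k → m * suc (2 * k) ≡ N
    odd-index halving-closed with BlockPartition.partition (λ x → ¬? (x ∈? elem)) (λ x≈y x∉H → x∉H ∘ ∈-resp-≈ (sym x≈y))
      pairBlock (pairBlock-injective halving-closed) pairBlock-∉ (λ _ → ∈-++⁺ˡ x∈coset[x]) (λ _ _ → pairBlock-meet)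
    ... | k , rep , complement-tiled = k , ≡.trans (arithmetic m k)
      (enumerates-size (enumerates-++ elem-enumerates (tiles⇒enumerates complement-tiled) disjoint) (toSum ∘ (_∈? elem)))
      where
      disjoint : ∀ i t → ¬ elem i ≈ concat (λ i j → pairBlock (rep i) j) t
      disjoint i t hi≈bt = proj₁ (proj₂ (tiles⇒enumerates complement-tiled)) t (i , hi≈bt)
      arithmetic : ∀ m k → m * suc (2 * k) ≡ m + k * (m + m)
      arithmetic = +-*-Solver.solve 2 (λ m k → m :* (con 1 :+ con 2 :* k) := m :+ k :* (m :+ m)) ≡.refl
        where open +-*-Solver

    extend-or-odd-index : Subgroup (m + m) ⊎ ∃ λ k → m * suc (2 * k) ≡ N
    extend-or-odd-index with Fin.any? (λ i → ¬? (enum i ∈? elem) ×-dec (enum i ∙ enum i ∈? elem))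
    ... | yes (i , u∉H , uu∈H) = inj₁ (extend u∉H uu∈H)
    ... | no none = inj₂ (odd-index λ {u} uu∈H → decidable-stable (u ∈? elem) λ u∉H →
      none (index u , (u∉H ∘ ∈-resp-≈ (enum-index u)) , ∈-resp-≈ (sym (∙-cong (enum-index u) (enum-index u))) uu∈H))

  module _ {t : ℕ} (N≡2^t : N ≡ 2 ^ t) where

    subgroup-2^ : ∀ j → j ≤ t → Subgroup (2 ^ j)
    subgroup-2^ zero    _   = trivialSubgroup
    subgroup-2^ (suc j) j<t with extend-or-odd-index (subgroup-2^ j (ℕ.<⇒≤ j<t))
    ... | inj₁ H = ≡.subst Subgroup (≡.cong (2 ^ j +_) (≡.sym (ℕ.+-identityʳ (2 ^ j)))) H
    ... | inj₂ (k , 2^j*odd≡N) = ⊥-elim (2^j*odd≢2^t k j<t (≡.trans 2^j*odd≡N N≡2^t))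

  square-factorisation : ∀ α → N ≡ 2 ^ (2 * α) →
    ∃₂ λ (b a : Vector Carrier (2 ^ α)) → IsArrayOfAll G (2 ^ α) (λ p q → b p ∙ a q)
  square-factorisation α N≡2^2α =
    let H = subgroup-2^ N≡2^2α α (ℕ.m≤m+n α (α + 0))
        k , rep , tiles = lagrange H
    in square (ℕ.*-cancelʳ-≡ k (2 ^ α) (2 ^ α) {{ℕ.m^n≢0 2 α}} (≡.trans (tiles-size tiles _) N≡2^α*2^α)) rep tiles
    where
    N≡2^α*2^α : N ≡ 2 ^ α * 2 ^ α
    N≡2^α*2^α = ≡.trans N≡2^2α (≡.trans (≡.cong (λ β → 2 ^ (α + β)) (ℕ.+-identityʳ α)) (ℕ.^-distribˡ-+-* 2 α α))
    square : ∀ {k n} {a : Vector Carrier n} → k ≡ n → (b : Vector Carrier k) → Tiles (λ p q → b p ∙ a q) (λ _ → ⊤) →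
      ∃₂ λ (b a : Vector Carrier n) → IsArrayOfAll G n (λ p q → b p ∙ a q)
    square ≡.refl b (ba-inj , _ , ba-surj) = b , _ , ba-inj , λ x → ba-surj x tt


theorem5p2 : {c ℓ : Level} (G : AbelianGroup c ℓ) (α : ℕ) → 2 ≤ α →
    HasOrder G (2 ^ (2 * α)) → MagicSquare G (2 ^ α)
theorem5p2 G α 2≤α order =
  let b , a , ba-lists-G = FiniteAbelianGroup.square-factorisation G order α ≡.refl
  in magicSquare G b a ba-lists-G (odls-2^ α 2≤α)
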